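{- Let $\ell\ge1$, $0\le k\le\ell$ and $b_1,\dots,b_\ell$ be numbers, $B=(b_1,\dots,b_\ell)$. Then $$\sum_{\overline G\subseteq[\ell],\ |\overline G|\le k}\ \prod_{i\in\overline G}(b_i-1)\,S_{\ell-k}(B(G))=\binom{\ell}{k}\prod_{i=1}^\ell b_i,$$ where for each $\overline G$ we write $G=[\ell]\setminus\overline G$.
   Context: $[\ell]=\{1,\dots,\ell\}$. For $X=\{x_1<\dots<x_n\}\subseteq[\ell]$, $B(X)=(b_{x_1},\dots,b_{x_n})$. $S_j(y_1,\dots,y_n)=\sum_{I\subseteq[n],|I|=j}\prod_{i\in I}y_i$ is the $j$-th elementary symmetric polynomial. -}

module Defs where

open import Level using (Level)
open import Data.Bool using (Bool; true; false; if_then_else_)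
open import Data.Nat using (ℕ; zero; suc; _≤_; _≟_)
open import Data.Fin using (Fin)
open import Data.Fin.Subset using (Subset; _∈_; ∣_∣; ∁)
open import Data.Fin.Subset.Properties using (_∈?_)
open import Data.List using (List; []; _∷_; map; filter; _++_; length)
import Data.Vec as Vec
open import Data.Vec using (Vec)
open import Relation.Nullary using (does)
open import Algebra.Bundles using (CommutativeRing)

allSubsets : (n : ℕ) → List (Subset n)
allSubsets zero = Vec.[] ∷ []
allSubsets (suc n) = map (false Vec.∷_) (allSubsets n) ++ map (true Vec.∷_) (allSubsets n)

module _ {c ℓ : Level} (R : CommutativeRing c ℓ) where
  open CommutativeRing R

  Σl : List Carrier → Carrier
  Σl [] = 0#
  Σl (x ∷ xs) = x + Σl xs

  Πl : List Carrier → Carrier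
  Πl [] = 1#
  Πl (x ∷ xs) = x * Πl xs

  elems : {n : ℕ} → Subset n → List (Fin n)
  elems {n} X = filter (λ i → i ∈? X) (Vec.toList (Vec.allFin n))

  prodOver : {n : ℕ} → (Fin n → Carrier) → Subset n → Carrier
  prodOver y X = Πl (map y (elems X))

  S : (j : ℕ) {n : ℕ} → Vec Carrier n → Carrier
  S j {n} y = Σl (map (prodOver (Vec.lookup y))
                      (filter (λ I → ∣ I ∣ ≟ j) (allSubsets n)))

  Bsub : {n : ℕ} → (b : Fin n → Carrier) → (X : Subset n) → Vec Carrier (length (map b (elems X)))
  Bsub b X = Vec.fromList (map b (elems X))

  LHS : (l k : ℕ) → (Fin l → Carrier) → Carrier
  LHS l k b = Σl (map (λ Gbar → prodOver (λ i → b i - 1#) Gbar * S (l Data.Nat.∸ k) (Bsub b (∁ Gbar)))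
                      (filter (λ Gbar → ∣ Gbar ∣ Data.Nat.≤? k) (allSubsets l)))

  _×'_ : ℕ → Carrier → Carrier
  zero ×' x = 0#
  suc n ×' x = x + (n ×' x)

-- Dropping the condition |Ḡ| ≤ k from the sum changes nothing: when |Ḡ| > k the set G has
-- fewer than ℓ − k elements, so S_{ℓ−k}(B(G)) = 0.  The full sum
-- F_n(j) = Σ_{Ḡ ⊆ [n]} ∏_{i∈Ḡ} (b_i − 1) S_j(B(G)) is computed by splitting on whether the first
-- index lies in Ḡ: since S_{j+1}(b₁, y) = b₁ S_j(y) + S_{j+1}(y), this gives
-- F_{n+1}(0) = b₁ F_n(0) and F_{n+1}(j+1) = b₁ (F_n(j) + F_n(j+1)), which is Pascal's rule, so
-- F_n(j) = C(n, j) ∏ b_i.  Finally C(ℓ, ℓ − k) = C(ℓ, k).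
module Submission where

open import Defs
open import Level using (Level)
open import Data.Nat using (ℕ; _≤_; _∸_)
open import Data.Nat.Combinatorics using (_C_)
open import Data.Fin using (Fin)
open import Data.Fin.Subset using (⊤)
open import Algebra.Bundles using (CommutativeRing)

import Algebra.Properties.CommutativeSemigroup as CommSemigroupProperties
open import Data.Bool using (true; false)
open import Data.Fin using (zero; suc)
open import Data.Fin.Subset using (Subset; ∣_∣; ∁)
open import Data.Fin.Subset.Properties using (_∈?_; ∣p∣≤n; ∣∁p∣≡n∸∣p∣)
open import Data.List using (List; []; _∷_; map; filter; _++_; length)
open import Data.List.Properties using (map-∘; length-map; filter-++; filter-none; ++-identityʳ)
import Data.List.Relation.Unary.All as All
import Data.Nat as ℕ
open import Data.Nat using (_<_; _≟_; _≤?_)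
open import Data.Nat.Combinatorics using (nCk≡nC[n∸k]; nCk+nC[k+1]≡[n+1]C[k+1])
import Data.Nat.Properties as ℕ
import Data.Vec as Vec
import Data.Vec.Properties as Vec
open import Function using (_∘_)
import Relation.Binary.Reasoning.Setoid as SetoidReasoning
open import Relation.Binary.PropositionalEquality as ≡ using (_≡_)
open import Relation.Nullary using (Dec; does; yes; no; ¬_)
open import Relation.Unary using (Pred; Decidable)

filter-map : ∀ {a b p q} {A : Set a} {B : Set b} {P : Pred B p} {Q : Pred A q}
  (P? : Decidable P) (Q? : Decidable Q) (f : A → B) →
  (∀ x → does (P? (f x)) ≡ does (Q? x)) →
  ∀ xs → filter P? (map f xs) ≡ map f (filter Q? xs)
filter-map P? Q? f P∘f≡Q [] = ≡.refl
filter-map P? Q? f P∘f≡Q (x ∷ xs) rewrite P∘f≡Q x with does (Q? x)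
... | true  = ≡.cong (f x ∷_) (filter-map P? Q? f P∘f≡Q xs)
... | false = filter-map P? Q? f P∘f≡Q xs

subsetsOfSize : (n j : ℕ) → List (Subset n)
subsetsOfSize n j = filter (λ I → ∣ I ∣ ≟ j) (allSubsets n)

subsetsOfSize-suc-zero : ∀ n →
  subsetsOfSize (ℕ.suc n) 0 ≡ map (false Vec.∷_) (subsetsOfSize n 0)
subsetsOfSize-suc-zero n = begin
  filter P? (map (false Vec.∷_) A ++ map (true Vec.∷_) A)
    ≡⟨ filter-++ P? (map (false Vec.∷_) A) _ ⟩
  filter P? (map (false Vec.∷_) A) ++ filter P? (map (true Vec.∷_) A)
    ≡⟨ ≡.cong₂ _++_ (filter-map P? P? (false Vec.∷_) (λ _ → ≡.refl) A)
                    (filter-map P? Q? (true Vec.∷_) (λ _ → ≡.refl) A) ⟩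
  map (false Vec.∷_) (filter P? A) ++ map (true Vec.∷_) (filter Q? A)
    ≡⟨ ≡.cong (λ xs → map (false Vec.∷_) (filter P? A) ++ map (true Vec.∷_) xs)
              (filter-none Q? (All.universal (λ _ ()) A)) ⟩
  map (false Vec.∷_) (filter P? A) ++ []
    ≡⟨ ++-identityʳ _ ⟩
  map (false Vec.∷_) (filter P? A) ∎
  where
  open ≡.≡-Reasoning
  A = allSubsets n
  P? : ∀ {m} (I : Subset m) → Dec (∣ I ∣ ≡ 0)
  P? I = ∣ I ∣ ≟ 0
  Q? : (I : Subset n) → Dec (∣ true Vec.∷ I ∣ ≡ 0)
  Q? I = ∣ true Vec.∷ I ∣ ≟ 0

subsetsOfSize-suc-suc : ∀ n j → subsetsOfSize (ℕ.suc n) (ℕ.suc j) ≡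
  map (false Vec.∷_) (subsetsOfSize n (ℕ.suc j)) ++ map (true Vec.∷_) (subsetsOfSize n j)
subsetsOfSize-suc-suc n j = ≡.trans (filter-++ P? (map (false Vec.∷_) A) _)
  (≡.cong₂ _++_ (filter-map P? P? (false Vec.∷_) (λ _ → ≡.refl) A)
                (filter-map P? (λ I → ∣ I ∣ ≟ j) (true Vec.∷_) (λ _ → ≡.refl) A))
  where
  A = allSubsets n
  P? : ∀ {m} (I : Subset m) → Dec (∣ I ∣ ≡ ℕ.suc j)
  P? I = ∣ I ∣ ≟ ℕ.suc j

module _ {c ℓ : Level} (R : CommutativeRing c ℓ) where
  open CommutativeRing R hiding (zero)
  open SetoidReasoning setoid

  elems-∷ : ∀ {n} x (X : Subset n) →
    filter (_∈? (x Vec.∷ X)) (Vec.toList (Vec.tabulate suc)) ≡ map suc (elems R X)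
  elems-∷ {n} x X = ≡.trans
    (≡.cong (filter (_∈? (x Vec.∷ X)))
            (≡.trans (≡.cong Vec.toList (Vec.tabulate-∘ suc (λ i → i)))
                     (Vec.toList-map suc (Vec.allFin n))))
    (filter-map (_∈? (x Vec.∷ X)) (_∈? X) suc (λ _ → ≡.refl) (Vec.toList (Vec.allFin n)))

  elems-false∷ : ∀ {n} (X : Subset n) → elems R (false Vec.∷ X) ≡ map suc (elems R X)
  elems-false∷ = elems-∷ false

  elems-true∷ : ∀ {n} (X : Subset n) → elems R (true Vec.∷ X) ≡ zero ∷ map suc (elems R X)
  elems-true∷ X = ≡.cong (zero ∷_) (elems-∷ true X)

  map-elems-false∷ : ∀ {a} {A : Set a} {n} (y : Fin (ℕ.suc n) → A) (X : Subset n) →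
    map y (elems R (false Vec.∷ X)) ≡ map (y ∘ suc) (elems R X)
  map-elems-false∷ y X = ≡.trans (≡.cong (map y) (elems-false∷ X)) (≡.sym (map-∘ (elems R X)))

  map-elems-true∷ : ∀ {a} {A : Set a} {n} (y : Fin (ℕ.suc n) → A) (X : Subset n) →
    map y (elems R (true Vec.∷ X)) ≡ y zero ∷ map (y ∘ suc) (elems R X)
  map-elems-true∷ y X =
    ≡.trans (≡.cong (map y) (elems-true∷ X)) (≡.cong (y zero ∷_) (≡.sym (map-∘ (elems R X))))

  length-elems : ∀ {n} (X : Subset n) → length (elems R X) ≡ ∣ X ∣
  length-elems Vec.[] = ≡.refl
  length-elems (false Vec.∷ X) =
    ≡.trans (≡.cong length (elems-false∷ X)) (≡.trans (length-map suc (elems R X)) (length-elems X))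
  length-elems (true Vec.∷ X) = ≡.trans (≡.cong length (elems-true∷ X))
    (≡.cong ℕ.suc (≡.trans (length-map suc (elems R X)) (length-elems X)))

  prodOver-false∷ : ∀ {n} (y : Fin (ℕ.suc n) → Carrier) (X : Subset n) →
    prodOver R y (false Vec.∷ X) ≡ prodOver R (y ∘ suc) X
  prodOver-false∷ y X = ≡.cong (Πl R) (map-elems-false∷ y X)

  prodOver-true∷ : ∀ {n} (y : Fin (ℕ.suc n) → Carrier) (X : Subset n) →
    prodOver R y (true Vec.∷ X) ≡ y zero * prodOver R (y ∘ suc) X
  prodOver-true∷ y X = ≡.cong (Πl R) (map-elems-true∷ y X)

  module _ {a} {A : Set a} where

    Σl-map-cong : ∀ {f g : A → Carrier} → (∀ x → f x ≈ g x) →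
      ∀ xs → Σl R (map f xs) ≈ Σl R (map g xs)
    Σl-map-cong f≈g [] = refl
    Σl-map-cong f≈g (x ∷ xs) = +-cong (f≈g x) (Σl-map-cong f≈g xs)

    Σl-map-map : ∀ {b} {B : Set b} (f : B → Carrier) (g : A → B) {h : A → Carrier} →
      (∀ x → f (g x) ≈ h x) → ∀ xs → Σl R (map f (map g xs)) ≈ Σl R (map h xs)
    Σl-map-map f g f∘g≈h xs =
      trans (reflexive (≡.cong (Σl R) (≡.sym (map-∘ xs)))) (Σl-map-cong f∘g≈h xs)

    Σl-map-++ : ∀ (f : A → Carrier) xs ys →
      Σl R (map f (xs ++ ys)) ≈ Σl R (map f xs) + Σl R (map f ys)
    Σl-map-++ f [] ys = sym (+-identityˡ _)
    Σl-map-++ f (x ∷ xs) ys = trans (+-congˡ (Σl-map-++ f xs ys)) (sym (+-assoc _ _ _))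

    Σl-map-+ : ∀ (f g : A → Carrier) xs →
      Σl R (map (λ x → f x + g x) xs) ≈ Σl R (map f xs) + Σl R (map g xs)
    Σl-map-+ f g [] = sym (+-identityˡ 0#)
    Σl-map-+ f g (x ∷ xs) =
      trans (+-congˡ (Σl-map-+ f g xs)) (interchange (f x) (g x) (Σl R (map f xs)) (Σl R (map g xs)))
      where open CommSemigroupProperties +-commutativeSemigroup using (interchange)

    Σl-map-*ˡ : ∀ a (f : A → Carrier) xs → Σl R (map (λ x → a * f x) xs) ≈ a * Σl R (map f xs)
    Σl-map-*ˡ a f [] = sym (zeroʳ a)
    Σl-map-*ˡ a f (x ∷ xs) = trans (+-congˡ (Σl-map-*ˡ a f xs)) (sym (distribˡ a _ _))

    Σl-map-filter : ∀ {p} {P : Pred A p} (P? : Decidable P) (f : A → Carrier) →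
      (∀ x → ¬ P x → f x ≈ 0#) → ∀ xs → Σl R (map f (filter P? xs)) ≈ Σl R (map f xs)
    Σl-map-filter P? f vanish [] = refl
    Σl-map-filter P? f vanish (x ∷ xs) with P? x
    ... | yes _  = +-congˡ (Σl-map-filter P? f vanish xs)
    ... | no ¬Px = trans (Σl-map-filter P? f vanish xs)
                         (sym (trans (+-congʳ (vanish x ¬Px)) (+-identityˡ _)))

  elemSym : ℕ → List Carrier → Carrier
  elemSym ℕ.zero    _        = 1#
  elemSym (ℕ.suc j) []       = 0#
  elemSym (ℕ.suc j) (x ∷ xs) = x * elemSym j xs + elemSym (ℕ.suc j) xs

  elemSym-vanishes : ∀ j xs → length xs < j → elemSym j xs ≈ 0#
  elemSym-vanishes (ℕ.suc j) [] _ = refl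
  elemSym-vanishes (ℕ.suc j) (x ∷ xs) (ℕ.s≤s ∣xs∣<j) = begin
    x * elemSym j xs + elemSym (ℕ.suc j) xs
      ≈⟨ +-cong (*-congˡ (elemSym-vanishes j xs ∣xs∣<j))
                (elemSym-vanishes (ℕ.suc j) xs (ℕ.m<n⇒m<1+n ∣xs∣<j)) ⟩
    x * 0# + 0#  ≈⟨ +-identityʳ _ ⟩
    x * 0#       ≈⟨ zeroʳ x ⟩
    0#           ∎

  S-fromList : ∀ j xs → S R j (Vec.fromList xs) ≈ elemSym j xs
  S-fromList ℕ.zero    []       = +-identityʳ 1#
  S-fromList (ℕ.suc j) []       = refl
  S-fromList ℕ.zero    (x ∷ xs) = begin
    Σl R (map (prodOver R y) (subsetsOfSize (ℕ.suc n) 0))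
      ≡⟨ ≡.cong (Σl R ∘ map (prodOver R y)) (subsetsOfSize-suc-zero n) ⟩
    Σl R (map (prodOver R y) (map (false Vec.∷_) (subsetsOfSize n 0)))
      ≈⟨ Σl-map-map (prodOver R y) _ (λ I → reflexive (prodOver-false∷ y I)) (subsetsOfSize n 0) ⟩
    S R 0 (Vec.fromList xs)
      ≈⟨ S-fromList 0 xs ⟩
    1# ∎
    where
    n = length xs
    y = Vec.lookup (Vec.fromList (x ∷ xs))
  S-fromList (ℕ.suc j) (x ∷ xs) = begin
    Σl R (map (prodOver R y) (subsetsOfSize (ℕ.suc n) (ℕ.suc j)))
      ≡⟨ ≡.cong (Σl R ∘ map (prodOver R y)) (subsetsOfSize-suc-suc n j) ⟩
    Σl R (map (prodOver R y) (map (false Vec.∷_) A₁ ++ map (true Vec.∷_) A₀))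
      ≈⟨ Σl-map-++ (prodOver R y) (map (false Vec.∷_) A₁) _ ⟩
    Σl R (map (prodOver R y) (map (false Vec.∷_) A₁))
      + Σl R (map (prodOver R y) (map (true Vec.∷_) A₀))
      ≈⟨ +-cong (Σl-map-map (prodOver R y) _ (λ I → reflexive (prodOver-false∷ y I)) A₁)
                (Σl-map-map (prodOver R y) _ (λ I → reflexive (prodOver-true∷ y I)) A₀) ⟩
    S R (ℕ.suc j) v + Σl R (map (λ I → x * prodOver R (Vec.lookup v) I) A₀)
      ≈⟨ +-cong (S-fromList (ℕ.suc j) xs) (Σl-map-*ˡ x _ A₀) ⟩
    elemSym (ℕ.suc j) xs + x * S R j v
      ≈⟨ +-congˡ (*-congˡ (S-fromList j xs)) ⟩
    elemSym (ℕ.suc j) xs + x * elemSym j xs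
      ≈⟨ +-comm _ _ ⟩
    x * elemSym j xs + elemSym (ℕ.suc j) xs ∎
    where
    n = length xs
    v = Vec.fromList xs
    y = Vec.lookup (Vec.fromList (x ∷ xs))
    A₀ = subsetsOfSize n j
    A₁ = subsetsOfSize n (ℕ.suc j)

  infixr 8 _×_
  _×_ : ℕ → Carrier → Carrier
  _×_ = _×'_ R

  ×-homo-+ : ∀ x m n → (m ℕ.+ n) × x ≈ m × x + n × x
  ×-homo-+ x ℕ.zero    n = sym (+-identityˡ _)
  ×-homo-+ x (ℕ.suc m) n = trans (+-congˡ (×-homo-+ x m n)) (sym (+-assoc _ _ _))

  ×-comm-* : ∀ n x y → x * (n × y) ≈ n × (x * y)
  ×-comm-* ℕ.zero    x y = zeroʳ x
  ×-comm-* (ℕ.suc n) x y = trans (distribˡ x y _) (+-congˡ (×-comm-* n x y))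

  ×-prodOver-⊤-suc : ∀ m {n} (b : Fin (ℕ.suc n) → Carrier) →
    b zero * (m × prodOver R (b ∘ suc) ⊤) ≈ m × prodOver R b ⊤
  ×-prodOver-⊤-suc m b =
    trans (×-comm-* m (b zero) _) (reflexive (≡.cong (m ×_) (≡.sym (prodOver-true∷ b ⊤))))

  x+[c-1]x≈cx : ∀ c x → x + (c - 1#) * x ≈ c * x
  x+[c-1]x≈cx c x = begin
    x + (c - 1#) * x          ≈⟨ +-congʳ (sym (*-identityˡ x)) ⟩
    1# * x + (c - 1#) * x     ≈⟨ sym (distribʳ x 1# (c - 1#)) ⟩
    (1# + (c - 1#)) * x       ≈⟨ *-congʳ (+-comm 1# (c - 1#)) ⟩
    ((c - 1#) + 1#) * x       ≈⟨ *-congʳ (+-assoc c (- 1#) 1#) ⟩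
    (c + (- 1# + 1#)) * x     ≈⟨ *-congʳ (+-congˡ (-‿inverseˡ 1#)) ⟩
    (c + 0#) * x              ≈⟨ *-congʳ (+-identityʳ c) ⟩
    c * x                     ∎

  fullSum : (n j : ℕ) → (Fin n → Carrier) → Carrier
  fullSum n j b = Σl R (map (λ G → prodOver R (λ i → b i - 1#) G * elemSym j (map b (elems R (∁ G))))
                            (allSubsets n))

  fullSum-suc : ∀ n j (b : Fin (ℕ.suc n) → Carrier) →
    fullSum (ℕ.suc n) j b ≈
      Σl R (map (λ G → prodOver R (λ i → b (suc i) - 1#) G
                         * elemSym j (b zero ∷ map (b ∘ suc) (elems R (∁ G))))
                (allSubsets n))
      + (b zero - 1#) * fullSum n j (b ∘ suc)
  fullSum-suc n j b = trans (Σl-map-++ summand (map (false Vec.∷_) A) (map (true Vec.∷_) A))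
    (+-cong (Σl-map-map summand _ zero∉G A)
            (trans (Σl-map-map summand _ zero∈G A) (Σl-map-*ˡ (b zero - 1#) _ A)))
    where
    A = allSubsets n
    summand = λ (G : Subset (ℕ.suc n)) →
      prodOver R (λ i → b i - 1#) G * elemSym j (map b (elems R (∁ G)))
    zero∉G = λ G → reflexive (≡.cong₂ _*_ (prodOver-false∷ (λ i → b i - 1#) G)
                                            (≡.cong (elemSym j) (map-elems-true∷ b (∁ G))))
    zero∈G = λ G → trans (reflexive (≡.cong₂ _*_ (prodOver-true∷ (λ i → b i - 1#) G)
                                                  (≡.cong (elemSym j) (map-elems-false∷ b (∁ G)))))
                           (*-assoc _ _ _)

  fullSum-suc-zero : ∀ n (b : Fin (ℕ.suc n) → Carrier) →
    fullSum (ℕ.suc n) 0 b ≈ b zero * fullSum n 0 (b ∘ suc)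
  fullSum-suc-zero n b = trans (fullSum-suc n 0 b) (x+[c-1]x≈cx (b zero) _)

  fullSum-suc-suc : ∀ n j (b : Fin (ℕ.suc n) → Carrier) →
    fullSum (ℕ.suc n) (ℕ.suc j) b
      ≈ b zero * (fullSum n j (b ∘ suc) + fullSum n (ℕ.suc j) (b ∘ suc))
  fullSum-suc-suc n j b = begin
    fullSum (ℕ.suc n) (ℕ.suc j) b
      ≈⟨ fullSum-suc n (ℕ.suc j) b ⟩
    Σl R (map (λ G → p G * (b₀ * u G + w G)) A) + (b₀ - 1#) * W₁
      ≈⟨ +-congʳ (Σl-map-cong (λ G → trans (distribˡ (p G) _ _) (+-congʳ (x∙yz≈y∙xz (p G) b₀ (u G))))
                              A) ⟩
    Σl R (map (λ G → b₀ * (p G * u G) + p G * w G) A) + (b₀ - 1#) * W₁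
      ≈⟨ +-congʳ (trans (Σl-map-+ _ _ A) (+-congʳ (Σl-map-*ˡ b₀ _ A))) ⟩
    (b₀ * W₀ + W₁) + (b₀ - 1#) * W₁
      ≈⟨ +-assoc _ _ _ ⟩
    b₀ * W₀ + (W₁ + (b₀ - 1#) * W₁)
      ≈⟨ +-congˡ (x+[c-1]x≈cx b₀ W₁) ⟩
    b₀ * W₀ + b₀ * W₁
      ≈⟨ sym (distribˡ b₀ W₀ W₁) ⟩
    b₀ * (W₀ + W₁) ∎
    where
    open CommSemigroupProperties *-commutativeSemigroup using (x∙yz≈y∙xz)
    A = allSubsets n
    b₀ = b zero
    p = prodOver R (λ i → b (suc i) - 1#)
    u = λ (G : Subset n) → elemSym j (map (b ∘ suc) (elems R (∁ G)))
    w = λ (G : Subset n) → elemSym (ℕ.suc j) (map (b ∘ suc) (elems R (∁ G)))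
    W₀ = fullSum n j (b ∘ suc)
    W₁ = fullSum n (ℕ.suc j) (b ∘ suc)

  fullSum≈binomial : ∀ n j (b : Fin n → Carrier) → fullSum n j b ≈ (n C j) × prodOver R b ⊤
  fullSum≈binomial ℕ.zero    ℕ.zero    b = +-congʳ (*-identityˡ 1#)
  fullSum≈binomial ℕ.zero    (ℕ.suc j) b = trans (+-identityʳ _) (zeroʳ 1#)
  fullSum≈binomial (ℕ.suc n) ℕ.zero    b = begin
    fullSum (ℕ.suc n) 0 b                  ≈⟨ fullSum-suc-zero n b ⟩
    b zero * fullSum n 0 (b ∘ suc)         ≈⟨ *-congˡ (fullSum≈binomial n 0 (b ∘ suc)) ⟩
    b zero * (1 × prodOver R (b ∘ suc) ⊤)  ≈⟨ ×-prodOver-⊤-suc 1 b ⟩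
    1 × prodOver R b ⊤                     ∎
  fullSum≈binomial (ℕ.suc n) (ℕ.suc j) b = begin
    fullSum (ℕ.suc n) (ℕ.suc j) b
      ≈⟨ fullSum-suc-suc n j b ⟩
    b zero * (fullSum n j (b ∘ suc) + fullSum n (ℕ.suc j) (b ∘ suc))
      ≈⟨ *-congˡ (+-cong (fullSum≈binomial n j (b ∘ suc))
                         (fullSum≈binomial n (ℕ.suc j) (b ∘ suc))) ⟩
    b zero * ((n C j) × A + (n C ℕ.suc j) × A)
      ≈⟨ *-congˡ (sym (×-homo-+ A (n C j) _)) ⟩
    b zero * ((n C j ℕ.+ n C ℕ.suc j) × A)
      ≡⟨ ≡.cong (λ m → b zero * (m × A)) (nCk+nC[k+1]≡[n+1]C[k+1] n j) ⟩
    b zero * ((ℕ.suc n C ℕ.suc j) × A)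
      ≈⟨ ×-prodOver-⊤-suc (ℕ.suc n C ℕ.suc j) b ⟩
    (ℕ.suc n C ℕ.suc j) × prodOver R b ⊤ ∎
    where A = prodOver R (b ∘ suc) ⊤

  LHS≈fullSum : ∀ l k (b : Fin l → Carrier) → LHS R l k b ≈ fullSum l (l ∸ k) b
  LHS≈fullSum l k b =
    trans (Σl-map-cong (λ G → *-congˡ (S-fromList (l ∸ k) _))
                       (filter (λ G → ∣ G ∣ ≤? k) (allSubsets l)))
          (Σl-map-filter (λ G → ∣ G ∣ ≤? k) _ too-large (allSubsets l))
    where
    too-large : ∀ G → ¬ ∣ G ∣ ≤ k →
      prodOver R (λ i → b i - 1#) G * elemSym (l ∸ k) (map b (elems R (∁ G))) ≈ 0#
    too-large G ∣G∣≰k = trans (*-congˡ (elemSym-vanishes (l ∸ k) _ short)) (zeroʳ _)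
      where
      short : length (map b (elems R (∁ G))) < l ∸ k
      short = ≡.subst (_< l ∸ k)
        (≡.sym (≡.trans (length-map b (elems R (∁ G)))
                        (≡.trans (length-elems (∁ G)) (∣∁p∣≡n∸∣p∣ G))))
        (ℕ.∸-monoʳ-< (ℕ.≰⇒> ∣G∣≰k) (∣p∣≤n G))

lemma3 : {c ℓ' : Level} (R : CommutativeRing c ℓ') (l k : ℕ) → 1 ≤ l → k ≤ l →
    (b : Fin l → CommutativeRing.Carrier R) →
    CommutativeRing._≈_ R (LHS R l k b) (_×'_ R (l C k) (prodOver R b ⊤))
lemma3 R l k _ k≤l b = begin
  LHS R l k b                                ≈⟨ LHS≈fullSum R l k b ⟩
  fullSum R l (l ∸ k) b                      ≈⟨ fullSum≈binomial R l (l ∸ k) b ⟩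
  _×'_ R (l C (l ∸ k)) (prodOver R b ⊤)      ≡⟨ ≡.cong (λ m → _×'_ R m (prodOver R b ⊤)) (nCk≡nC[n∸k] k≤l) ⟨
  _×'_ R (l C k) (prodOver R b ⊤)            ∎
  where open SetoidReasoning (CommutativeRing.setoid R)
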